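{- Let $R$ be a Noetherian ring. Every digraph of ideals on $\mathrm{Spec}(R)$ has a digraph of global generators on the same open subsets: that is, a digraph of global generators with the same underlying rooted graph and the same distinguished opens at the nodes, whose associated digraph of ideals is the given one.
   Context: Rings are commutative with unit. For $f\in R$, $D(f)$ is the distinguished open of $\mathrm{Spec}(R)$ and $R_f$ the localization. A digraph of ideals on $\mathrm{Spec}(R)$ is a rooted directed graph whose nodes are pairs $\langle D(f),K\rangle$ with $K$ an ideal of $R_f$ (a node depends only on the open set $D(f)$), such that: the root is $\langle\mathrm{Spec}(R),I\rangle$ for some ideal $I$ of $R$; each distinguished open occurs in at most one node; an edge $\langle D(g),H\rangle\to\langle D(f),K\rangle$ implies $D(f)\subsetneq D(g)$ and $K\supsetneq H R_f$. A digraph of global generators is a rooted directed graph with nodes $\langle D(f),G_f\rangle$, $G_f$ a finite subset of $R$ (not merely of $R_f$), such that replacing each $G_f$ by the ideal $K=G_fR_f$ of $R_f$ generated by $G_f$ yields a digraph of ideals (its associated digraph of ideals). -}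

module Defs where

open import Level using (Level; _⊔_) renaming (suc to lsuc)
open import Algebra.Bundles using (CommutativeRing)
open import Data.Nat using (ℕ; zero; suc) renaming (_+_ to _+ℕ_)
open import Data.List using (List; []; _∷_; foldr; map)
open import Data.List.Membership.Propositional using (_∈_)
open import Data.List.Relation.Unary.All using (All)
open import Data.Product using (Σ; ∃; _×_; _,_; proj₁; proj₂)
open import Data.Sum using (_⊎_)
open import Relation.Nullary using (¬_)
open import Relation.Binary.PropositionalEquality using (_≡_)

record RootedDigraph (v e : Level) : Set (lsuc (v ⊔ e)) where
  field
    V    : Set v
    E    : V → V → Set e
    root : V

module _ {c ℓ : Level} (R : CommutativeRing c ℓ) where
  open CommutativeRing R renaming (Carrier to A)

  infixl 6 _⊖_
  _⊖_ : A → A → A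
  x ⊖ y = x + (- y)

  pow : A → ℕ → A
  pow x zero    = 1#
  pow x (suc n) = x * pow x n

  record IsIdeal {p : Level} (P : A → Set p) : Set (c ⊔ ℓ ⊔ p) where
    field
      resp  : ∀ {x y} → x ≈ y → P x → P y
      zero∈ : P 0#
      +∈    : ∀ {x y} → P x → P y → P (x + y)
      *∈    : ∀ r {x} → P x → P (r * x)

  -- Prime ideals = points of Spec(R)
  record IsPrime (P : A → Set (c ⊔ ℓ)) : Set (c ⊔ ℓ) where
    field
      ideal  : IsIdeal P
      proper : ¬ P 1#
      prime  : ∀ x y → P (x * y) → P x ⊎ P y

  -- D(f) = { P ∈ Spec R | f ∉ P }
  -- D(f) ⊆ D(g)
  _⊆D_ : A → A → Set (lsuc (c ⊔ ℓ))
  f ⊆D g = ∀ (P : A → Set (c ⊔ ℓ)) → IsPrime P → ¬ P f → ¬ P g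

  _⊊D_ : A → A → Set (lsuc (c ⊔ ℓ))
  f ⊊D g = (f ⊆D g) × ¬ (g ⊆D f)

  IsWholeSpec : A → Set (lsuc (c ⊔ ℓ))
  IsWholeSpec f = ∀ (P : A → Set (c ⊔ ℓ)) → IsPrime P → ¬ P f

  Span : List A → A → Set (c ⊔ ℓ)
  Span gs x = Σ (List (A × A)) λ ps →
    All (λ q → proj₂ q ∈ gs) ps × (x ≈ foldr (λ q acc → proj₁ q * proj₂ q + acc) 0# ps)

  Noetherian : (p : Level) → Set (c ⊔ ℓ ⊔ lsuc p)
  Noetherian p = ∀ (P : A → Set p) → IsIdeal P →
    Σ (List A) λ gs → (∀ g → g ∈ gs → P g) × (∀ x → P x → Span gs x)

  -- Localization R_f: a pair (a , n) represents a / f^n.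
  module Loc (f : A) where
    Frac : Set c
    Frac = A × ℕ

    _~_ : Frac → Frac → Set ℓ
    (a , n) ~ (b , m) = ∃ λ k → pow f k * (a * pow f m ⊖ b * pow f n) ≈ 0#

    _⊕_ : Frac → Frac → Frac
    (a , n) ⊕ (b , m) = (a * pow f m + b * pow f n , n +ℕ m)

    _⊗_ : Frac → Frac → Frac
    (a , n) ⊗ (b , m) = (a * b , n +ℕ m)

    𝟘 : Frac
    𝟘 = (0# , 0)

    ι : A → Frac
    ι a = (a , 0)

    record IsLocIdeal {p : Level} (P : Frac → Set p) : Set (c ⊔ ℓ ⊔ p) where
      field
        resp  : ∀ {x y} → x ~ y → P x → P y
        zero∈ : P 𝟘
        +∈    : ∀ {x y} → P x → P y → P (x ⊕ y)
        *∈    : ∀ r {x} → P x → P (r ⊗ x)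

    Gen : ∀ {s} → (Frac → Set s) → Frac → Set (c ⊔ ℓ ⊔ s)
    Gen S y = Σ (List (Frac × Frac)) λ ps →
      All (λ q → S (proj₂ q)) ps × (y ~ foldr (λ q acc → (proj₁ q ⊗ proj₂ q) ⊕ acc) 𝟘 ps)

  GenGlobal : (f : A) → List A → Loc.Frac f → Set (c ⊔ ℓ)
  GenGlobal f G = Loc.Gen f (λ x → Σ A λ a → a ∈ G × x ≡ Loc.ι f a)

  -- H R_f : extension of an ideal H of R_g to R_f (used when D(f) ⊆ D(g)):
  -- generated by the images of a/g^m ∈ H, i.e. the x ∈ R_f with x · (g^m/1) = a/1.
  Ext : ∀ {p} (g f : A) → (Loc.Frac g → Set p) → Loc.Frac f → Set (c ⊔ ℓ ⊔ p)
  Ext g f H = Loc.Gen f (λ x → Σ (Loc.Frac g) λ am →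
    H am × Loc._~_ f (Loc._⊗_ f x (Loc.ι f (pow g (proj₂ am)))) (Loc.ι f (proj₁ am)))

  _⊆I_ : ∀ {X : Set c} {p q} → (X → Set p) → (X → Set q) → Set (c ⊔ p ⊔ q)
  P ⊆I Q = ∀ x → P x → Q x

  _⊊I_ : ∀ {X : Set c} {p q} → (X → Set p) → (X → Set q) → Set (c ⊔ p ⊔ q)
  P ⊊I Q = (P ⊆I Q) × ¬ (Q ⊆I P)

  record IsDigraphOfIdeals {v e p} (Γ : RootedDigraph v e)
      (op : RootedDigraph.V Γ → A)
      (ideal : (x : RootedDigraph.V Γ) → Loc.Frac (op x) → Set p)
      : Set (lsuc (c ⊔ ℓ) ⊔ v ⊔ e ⊔ p) where
    open RootedDigraph Γ
    field
      isIdeal   : ∀ x → Loc.IsLocIdeal (op x) (ideal x)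
      rootSpec  : IsWholeSpec (op root)
      opInj     : ∀ x y → op x ⊆D op y → op y ⊆D op x → x ≡ y
      edgeOpen  : ∀ {x y} → E x y → op y ⊊D op x
      edgeIdeal : ∀ {x y} → E x y → Ext (op x) (op y) (ideal x) ⊊I ideal y

  record DigraphOfIdeals {v e} (Γ : RootedDigraph v e) (p : Level)
      : Set (lsuc (c ⊔ ℓ ⊔ p) ⊔ v ⊔ e) where
    field
      op    : RootedDigraph.V Γ → A
      ideal : (x : RootedDigraph.V Γ) → Loc.Frac (op x) → Set p
      isDigraph : IsDigraphOfIdeals Γ op ideal

  IsDigraphOfGlobalGenerators : ∀ {v e} (Γ : RootedDigraph v e)
      (op : RootedDigraph.V Γ → A) (gens : RootedDigraph.V Γ → List A)
      → Set (lsuc (c ⊔ ℓ) ⊔ v ⊔ e)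
  IsDigraphOfGlobalGenerators Γ op gens =
    IsDigraphOfIdeals Γ op (λ x → GenGlobal (op x) (gens x))

module Submission where

-- Let K be an ideal of R_f and let K^c = { a ∈ R | a/1 ∈ K } be its
-- contraction, an ideal of R.  Since R is Noetherian, K^c is generated by a finite
-- list G ⊆ R, and then G·R_f = K: every generator lies in K, and conversely for
-- a/fⁿ ∈ K we have a = (fⁿ/1)·(a/fⁿ) ∈ K^c, so a = Σ rᵢgᵢ and a/fⁿ = Σ (rᵢ/fⁿ)(gᵢ/1).
-- Choosing such a G at every node of a digraph of ideals gives labels G·R_f that
-- coincide (as subsets of R_f) with the given ideals; all conditions of a digraph
-- of ideals are invariant under replacing the labels by equal ones, because the
-- extension H·R_f is monotone in H.

open import Defs
open import Level using (Level)
open import Algebra.Bundles using (CommutativeRing; Ring)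
open import Data.List using (List; []; _∷_; foldr; map)
open import Data.List.Relation.Unary.All using (All; []; _∷_) renaming (map to All-map)
open import Data.List.Membership.Propositional using (_∈_)
open import Data.Nat using (ℕ; zero; suc) renaming (_+_ to _+ℕ_)
open import Data.Product using (Σ; _×_; _,_; proj₁; proj₂)
open import Relation.Binary.PropositionalEquality as ≡ using (_≡_)

Ext-mono : ∀ {c ℓ p q} (R : CommutativeRing c ℓ) (g f : CommutativeRing.Carrier R)
  {H : Loc.Frac R g → Set p} {H' : Loc.Frac R g → Set q} →
  _⊆I_ R H H' → _⊆I_ R (Ext R g f H) (Ext R g f H')
Ext-mono R g f H⊆H' y (ps , gens∈H , y~sum) =
  ps , All-map (λ { (am , am∈H , e) → am , H⊆H' am am∈H , e }) gens∈H , y~sum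

_≐_ : ∀ {c ℓ p q} {R : CommutativeRing c ℓ} {X : Set c} → (X → Set p) → (X → Set q) → Set _
_≐_ {R = R} P Q = _⊆I_ R P Q × _⊆I_ R Q P

IsLocIdeal-≐ : ∀ {c ℓ p q} (R : CommutativeRing c ℓ) (f : CommutativeRing.Carrier R)
  {K : Loc.Frac R f → Set p} {L : Loc.Frac R f → Set q} →
  _≐_ {R = R} K L → Loc.IsLocIdeal R f K → Loc.IsLocIdeal R f L
IsLocIdeal-≐ R f {K} {L} (K⊆L , L⊆K) K-ideal = record
  { resp  = λ {x} {y} x~y x∈L → K⊆L y (KI.resp x~y (L⊆K x x∈L))
  ; zero∈ = K⊆L _ KI.zero∈
  ; +∈    = λ {x} {y} x∈L y∈L → K⊆L _ (KI.+∈ (L⊆K x x∈L) (L⊆K y y∈L))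
  ; *∈    = λ r {x} x∈L → K⊆L _ (KI.*∈ r (L⊆K x x∈L))
  }
  where module KI = Loc.IsLocIdeal K-ideal

IsDigraphOfIdeals-≐ : ∀ {c ℓ p q v e} (R : CommutativeRing c ℓ) (Γ : RootedDigraph v e)
  (op : RootedDigraph.V Γ → CommutativeRing.Carrier R)
  {I : (x : RootedDigraph.V Γ) → Loc.Frac R (op x) → Set p}
  {J : (x : RootedDigraph.V Γ) → Loc.Frac R (op x) → Set q} →
  (∀ x → _≐_ {R = R} (I x) (J x)) →
  IsDigraphOfIdeals R Γ op I → IsDigraphOfIdeals R Γ op J
IsDigraphOfIdeals-≐ R Γ op {I} {J} I≐J isDigraph = record
  { isIdeal   = λ x → IsLocIdeal-≐ R (op x) (I≐J x) (isIdeal x)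
  ; rootSpec  = rootSpec
  ; opInj     = opInj
  ; edgeOpen  = edgeOpen
  ; edgeIdeal = λ {x} {y} x→y →
      let (ExtI⊆I , I⊈ExtI) = edgeIdeal x→y in
        (λ z z∈ExtJ → proj₁ (I≐J y) z
           (ExtI⊆I z (Ext-mono R (op x) (op y) (proj₂ (I≐J x)) z z∈ExtJ)))
      , (λ J⊆ExtJ → I⊈ExtI (λ z z∈I → Ext-mono R (op x) (op y) (proj₂ (I≐J x)) z
           (J⊆ExtJ z (proj₁ (I≐J y) z z∈I))))
  }
  where open IsDigraphOfIdeals isDigraph

module Localisation {c ℓ} (R : CommutativeRing c ℓ) (f : CommutativeRing.Carrier R) where
  open CommutativeRing R renaming (Carrier to A)
  open Loc R f
  open import Relation.Binary.Reasoning.Setoid setoid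
  open import Algebra.Properties.RingWithoutOne (Ring.ringWithoutOne ring) using (x[y-z]≈xy-xz)
  open import Algebra.Properties.AbelianGroup +-abelianGroup using (x∙y⁻¹≈ε⇒x≈y; x≈y⇒x∙y⁻¹≈ε)

  pow-+ : ∀ m n → pow R f (m +ℕ n) ≈ pow R f m * pow R f n
  pow-+ zero    n = sym (*-identityˡ _)
  pow-+ (suc m) n = trans (*-cong refl (pow-+ m n)) (sym (*-assoc _ _ _))

  pow-+0 : ∀ n → pow R f (n +ℕ 0) ≈ pow R f n
  pow-+0 n = trans (pow-+ n 0) (*-identityʳ _)

  ~-intro : ∀ x y → proj₁ x * pow R f (proj₂ y) ≈ proj₁ y * pow R f (proj₂ x) → x ~ y
  ~-intro _ _ e = 0 , trans (x[y-z]≈xy-xz 1# _ _) (x≈y⇒x∙y⁻¹≈ε (*-cong refl e))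

  ~-sym : ∀ {x y} → x ~ y → y ~ x
  ~-sym (k , e) = k , trans (x[y-z]≈xy-xz _ _ _) (x≈y⇒x∙y⁻¹≈ε
    (sym (x∙y⁻¹≈ε⇒x≈y _ _ (trans (sym (x[y-z]≈xy-xz _ _ _)) e))))

  Contraction : ∀ {p} → (Frac → Set p) → A → Set p
  Contraction K a = K (ι a)

  Contraction-isIdeal : ∀ {p} {K : Frac → Set p} → IsLocIdeal K → IsIdeal R (Contraction K)
  Contraction-isIdeal K-ideal = record
    { resp  = λ {a} {b} a≈b → KI.resp (~-intro (ι a) (ι b) (*-cong a≈b refl))
    ; zero∈ = KI.zero∈
    ; +∈    = λ {a} {b} a∈ b∈ → KI.resp
        (~-intro (ι a ⊕ ι b) (ι (a + b)) (*-cong (+-cong (*-identityʳ _) (*-identityʳ _)) refl))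
        (KI.+∈ a∈ b∈)
    ; *∈    = λ r a∈ → KI.*∈ (ι r) a∈
    }
    where module KI = IsLocIdeal K-ideal

  -- The numerator a of any a/fⁿ ∈ K lies in K^c, since a/1 = (fⁿ/1)·(a/fⁿ).
  numerator∈Contraction : ∀ {p} {K : Frac → Set p} → IsLocIdeal K →
    ∀ a n → K (a , n) → Contraction K a
  numerator∈Contraction K-ideal a n a/fⁿ∈K =
    IsLocIdeal.resp K-ideal (~-intro (ι (pow R f n) ⊗ (a , n)) (ι a) (trans (*-identityʳ _) (*-comm _ _)))
      (IsLocIdeal.*∈ K-ideal (ι (pow R f n)) a/fⁿ∈K)

  term : Frac × Frac → Frac → Frac
  term q acc = (proj₁ q ⊗ proj₂ q) ⊕ acc

  overPow : ℕ → A × A → Frac × Frac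
  overPow n (r , g) = (r , n) , ι g

  combination : List (A × A) → A
  combination = foldr (λ q acc → proj₁ q * proj₂ q + acc) 0#

  combination-overPow : ∀ n ps →
    let (X , d) = foldr term 𝟘 (map (overPow n) ps) in
    X * pow R f n ≈ combination ps * pow R f d
  combination-overPow n [] = trans (zeroˡ _) (sym (zeroˡ _))
  combination-overPow n ((r , g) ∷ ps) = begin
      (r * g * pow R f d + X * pow R f (n +ℕ 0)) * pow R f n
        ≈⟨ *-cong (+-cong refl (*-cong refl (pow-+0 n))) refl ⟩
      (r * g * pow R f d + X * pow R f n) * pow R f n
        ≈⟨ *-cong (+-cong refl (combination-overPow n ps)) refl ⟩
      (r * g * pow R f d + combination ps * pow R f d) * pow R f n
        ≈⟨ *-cong (sym (distribʳ _ _ _)) refl ⟩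
      (r * g + combination ps) * pow R f d * pow R f n
        ≈⟨ *-assoc _ _ _ ⟩
      (r * g + combination ps) * (pow R f d * pow R f n)
        ≈⟨ *-cong refl (*-comm _ _) ⟩
      (r * g + combination ps) * (pow R f n * pow R f d)
        ≈⟨ *-cong refl (sym (trans (pow-+ (n +ℕ 0) d) (*-cong (pow-+0 n) refl))) ⟩
      (r * g + combination ps) * pow R f ((n +ℕ 0) +ℕ d) ∎
    where
      X = proj₁ (foldr term 𝟘 (map (overPow n) ps))
      d = proj₂ (foldr term 𝟘 (map (overPow n) ps))

  module _ {p} {K : Frac → Set p} (K-ideal : IsLocIdeal K) (G : List A) where
    module KI = IsLocIdeal K-ideal

    GenGlobal⊆ : (∀ g → g ∈ G → Contraction K g) → _⊆I_ R (GenGlobal R f G) K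
    GenGlobal⊆ G⊆Kᶜ y (qs , gens∈G , y~sum) = KI.resp (~-sym {y} {foldr term 𝟘 qs} y~sum) (sum∈K qs gens∈G)
      where
        sum∈K : ∀ qs → All (λ q → Σ A λ a → a ∈ G × proj₂ q ≡ ι a) qs → K (foldr term 𝟘 qs)
        sum∈K []       []                       = KI.zero∈
        sum∈K (q ∷ qs) ((g , g∈G , q≡g) ∷ rest) =
          KI.+∈ (KI.*∈ (proj₁ q) (≡.subst K (≡.sym q≡g) (G⊆Kᶜ g g∈G))) (sum∈K qs rest)

    ⊆GenGlobal : (∀ a → Contraction K a → Span R G a) → _⊆I_ R K (GenGlobal R f G)
    ⊆GenGlobal Kᶜ⊆RG (a , n) a/fⁿ∈K
      with Kᶜ⊆RG a (numerator∈Contraction K-ideal a n a/fⁿ∈K)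
    ... | ps , ps∈G , a≈sum =
      map (overPow n) ps , overPow-gens ps ps∈G ,
      ~-intro (a , n) (foldr term 𝟘 (map (overPow n) ps)) (trans (*-cong a≈sum refl) (sym (combination-overPow n ps)))
      where
        overPow-gens : ∀ ps → All (λ q → proj₂ q ∈ G) ps →
          All (λ q → Σ A λ a → a ∈ G × proj₂ q ≡ ι a) (map (overPow n) ps)
        overPow-gens []      []          = []
        overPow-gens (q ∷ ps) (g∈G ∷ rest) = (proj₂ q , g∈G , ≡.refl) ∷ overPow-gens ps rest

  globalGenerators : ∀ {p} → Noetherian R p → {K : Frac → Set p} → IsLocIdeal K →
    Σ (List A) λ G → _≐_ {R = R} K (GenGlobal R f G)
  globalGenerators noeth K-ideal
    with noeth _ (Contraction-isIdeal K-ideal)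
  ... | G , G⊆Kᶜ , Kᶜ⊆RG = G , ⊆GenGlobal K-ideal G Kᶜ⊆RG , GenGlobal⊆ K-ideal G G⊆Kᶜ

mainTheorem6 : ∀ {c ℓ p v e : Level} (R : CommutativeRing c ℓ) → Noetherian R p →
    (Γ : RootedDigraph v e) (𝒟 : DigraphOfIdeals R Γ p) →
    Σ (RootedDigraph.V Γ → List (CommutativeRing.Carrier R)) λ gens →
      IsDigraphOfGlobalGenerators R Γ (DigraphOfIdeals.op 𝒟) gens
      × (∀ x → _⊆I_ R (DigraphOfIdeals.ideal 𝒟 x) (GenGlobal R (DigraphOfIdeals.op 𝒟 x) (gens x))
             × _⊆I_ R (GenGlobal R (DigraphOfIdeals.op 𝒟 x) (gens x)) (DigraphOfIdeals.ideal 𝒟 x))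
mainTheorem6 R noeth Γ 𝒟 =
  gens , IsDigraphOfIdeals-≐ R Γ op ideal≐gens isDigraph , ideal≐gens
  where
    open DigraphOfIdeals 𝒟

    generatorsAt : ∀ x → Σ (List (CommutativeRing.Carrier R)) λ G →
                           _≐_ {R = R} (ideal x) (GenGlobal R (op x) G)
    generatorsAt x = Localisation.globalGenerators R (op x) noeth
                       (IsDigraphOfIdeals.isIdeal isDigraph x)

    gens : RootedDigraph.V Γ → List (CommutativeRing.Carrier R)
    gens x = proj₁ (generatorsAt x)

    ideal≐gens : ∀ x → _≐_ {R = R} (ideal x) (GenGlobal R (op x) (gens x))
    ideal≐gens x = proj₂ (generatorsAt x)
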